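{- For every MV-monoidal algebra $A$, the algebra $\mathrm{GS}(A)$ of good sequences in $A$ is a positive unital commutative lattice-ordered monoid.
   Context: An MV-monoidal algebra is an algebra $\langle A;\oplus,\odot,\vee,\wedge,0,1\rangle$ satisfying: $\langle A;\vee,\wedge\rangle$ is a distributive lattice; $\langle A;\oplus,0\rangle$ and $\langle A;\odot,1\rangle$ are commutative monoids; $\oplus$ and $\odot$ both distribute over both $\vee$ and $\wedge$; $(x\oplus y)\odot((x\odot y)\oplus z)=(x\odot(y\oplus z))\oplus(y\odot z)$; $(x\odot y)\oplus((x\oplus y)\odot z)=(x\oplus(y\odot z))\odot(y\oplus z)$; $(x\odot y)\oplus z=((x\oplus y)\odot((x\odot y)\oplus z))\vee z$; $(x\oplus y)\odot z=((x\odot y)\oplus((x\oplus y)\odot z))\wedge z$. A good pair is $(x_0,x_1)$ with $x_0\oplus x_1=x_0$, $x_0\odot x_1=x_1$; a good sequence is a sequence $(a_0,a_1,\dots)$ in $A$, eventually $0$, with every $(a_n,a_{n+1})$ good. $\mathrm{GS}(A)$ is the set of good sequences with $\mathbf0=(0,0,\dots)$, $\mathbf1=(1,0,0,\dots)$, $\vee$ and $\wedge$ componentwise, $(\mathbf a+\mathbf b)_n=(a_0\oplus b_n)\odot(a_1\oplus b_{n-1})\odot\dots\odot(a_n\oplus b_0)$, and $(a_0,a_1,a_2,\dots)\ominus1=(a_1,a_2,\dots)$. A positive unital commutative lattice-ordered monoid is an algebra $\langle M;+,\vee,\wedge,0,1,-\ominus1\rangle$ such that $\langle M;\vee,\wedge\rangle$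 is a distributive lattice, $\langle M;+,0\rangle$ is a commutative monoid, $+$ distributes over $\vee$ and $\wedge$, and for all $x$: $x\ge0$; $(x+1)\ominus1=x$; $(x\ominus1)+1=x\vee1$; $x\le1+\dots+1$ for some finite number of summands. -}

module Defs where

open import Level using (0ℓ)
open import Data.Nat using (ℕ; zero; suc; _∸_; _≤_)
open import Data.Product using (Σ; ∃; _×_; _,_; proj₁; proj₂)
open import Relation.Binary.PropositionalEquality using (_≡_)
open import Relation.Binary.Core using (Rel)
open import Algebra.Core using (Op₁; Op₂)
open import Algebra.Definitions using (_DistributesOver_)
open import Algebra.Structures using (IsCommutativeMonoid)
open import Algebra.Lattice.Structures using (IsDistributiveLattice)

record MVMonoidal : Set₁ where
  infixl 6 _⊕_
  infixl 7 _⊙_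
  field
    Carrier : Set
    _⊕_ _⊙_ _∨_ _∧_ : Op₂ Carrier
    𝟘 𝟙 : Carrier
    isDistributiveLattice : IsDistributiveLattice _≡_ _∨_ _∧_
    ⊕-isCommutativeMonoid : IsCommutativeMonoid _≡_ _⊕_ 𝟘
    ⊙-isCommutativeMonoid : IsCommutativeMonoid _≡_ _⊙_ 𝟙
    ⊕-distrib-∨ : _DistributesOver_ _≡_ _⊕_ _∨_
    ⊕-distrib-∧ : _DistributesOver_ _≡_ _⊕_ _∧_
    ⊙-distrib-∨ : _DistributesOver_ _≡_ _⊙_ _∨_
    ⊙-distrib-∧ : _DistributesOver_ _≡_ _⊙_ _∧_
    ax1 : ∀ x y z → (x ⊕ y) ⊙ ((x ⊙ y) ⊕ z) ≡ (x ⊙ (y ⊕ z)) ⊕ (y ⊙ z)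
    ax2 : ∀ x y z → (x ⊙ y) ⊕ ((x ⊕ y) ⊙ z) ≡ (x ⊕ (y ⊙ z)) ⊙ (y ⊕ z)
    ax3 : ∀ x y z → (x ⊙ y) ⊕ z ≡ ((x ⊕ y) ⊙ ((x ⊙ y) ⊕ z)) ∨ z
    ax4 : ∀ x y z → (x ⊕ y) ⊙ z ≡ ((x ⊙ y) ⊕ ((x ⊕ y) ⊙ z)) ∧ z

module GoodSequences (A : MVMonoidal) where
  open MVMonoidal A

  Seq : Set
  Seq = ℕ → Carrier

  IsGoodPair : Carrier → Carrier → Set
  IsGoodPair x₀ x₁ = (x₀ ⊕ x₁ ≡ x₀) × (x₀ ⊙ x₁ ≡ x₁)

  IsGoodSeq : Seq → Set
  IsGoodSeq a = (∃ λ N → ∀ n → N ≤ n → a n ≡ 𝟘)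
              × (∀ n → IsGoodPair (a n) (a (suc n)))

  GS : Set
  GS = Σ Seq IsGoodSeq

  _≈GS_ : Rel GS 0ℓ
  a ≈GS b = ∀ n → proj₁ a n ≡ proj₁ b n

  ⊙-upTo : (ℕ → Carrier) → ℕ → Carrier
  ⊙-upTo f zero = f zero
  ⊙-upTo f (suc n) = ⊙-upTo f n ⊙ f (suc n)

  zeroSeq oneSeq : Seq
  zeroSeq n = 𝟘
  oneSeq zero = 𝟙
  oneSeq (suc n) = 𝟘

  plusSeq : Seq → Seq → Seq
  plusSeq a b n = ⊙-upTo (λ i → a i ⊕ b (n ∸ i)) n

  joinSeq meetSeq : Seq → Seq → Seq
  joinSeq a b n = a n ∨ b n
  meetSeq a b n = a n ∧ b n

  minusOneSeq : Seq → Seq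
  minusOneSeq a n = a (suc n)

  record Closure : Set where
    field
      zero-good  : IsGoodSeq zeroSeq
      one-good   : IsGoodSeq oneSeq
      plus-good  : ∀ {a b} → IsGoodSeq a → IsGoodSeq b → IsGoodSeq (plusSeq a b)
      join-good  : ∀ {a b} → IsGoodSeq a → IsGoodSeq b → IsGoodSeq (joinSeq a b)
      meet-good  : ∀ {a b} → IsGoodSeq a → IsGoodSeq b → IsGoodSeq (meetSeq a b)
      minusOne-good : ∀ {a} → IsGoodSeq a → IsGoodSeq (minusOneSeq a)

  module Ops (cl : Closure) where
    open Closure cl
    𝟎 𝟏 : GS
    𝟎 = zeroSeq , zero-good
    𝟏 = oneSeq , one-good
    _+GS_ _∨GS_ _∧GS_ : Op₂ GS
    (a , p) +GS (b , q) = plusSeq a b , plus-good p q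
    (a , p) ∨GS (b , q) = joinSeq a b , join-good p q
    (a , p) ∧GS (b , q) = meetSeq a b , meet-good p q
    _⊖1GS : Op₁ GS
    (a , p) ⊖1GS = minusOneSeq a , minusOne-good p

module _ {M : Set} (_≈_ : Rel M 0ℓ) where

  times1 : Op₂ M → M → M → ℕ → M
  times1 _+_ 0# 1# zero = 0#
  times1 _+_ 0# 1# (suc n) = 1# + times1 _+_ 0# 1# n

  record IsPUCLMonoid (_+_ _∨_ _∧_ : Op₂ M) (0# 1# : M) (_⊖1 : Op₁ M) : Set where
    _≤M_ : M → M → Set
    x ≤M y = (x ∧ y) ≈ x
    field
      isDistributiveLattice : IsDistributiveLattice _≈_ _∨_ _∧_
      +-isCommutativeMonoid : IsCommutativeMonoid _≈_ _+_ 0#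
      +-distrib-∨ : _DistributesOver_ _≈_ _+_ _∨_
      +-distrib-∧ : _DistributesOver_ _≈_ _+_ _∧_
      ⊖1-cong : ∀ {x y} → x ≈ y → (x ⊖1) ≈ (y ⊖1)
      positive : ∀ x → 0# ≤M x
      +1⊖1 : ∀ x → ((x + 1#) ⊖1) ≈ x
      ⊖1+1 : ∀ x → ((x ⊖1) + 1#) ≈ (x ∨ 1#)
      unital : ∀ x → ∃ λ n → x ≤M times1 _+_ 0# 1# n

{-# OPTIONS --safe #-}
-- A good sequence a is a ⊙-decreasing chain that vanishes from some index N on,
-- and a + b unfolds as a₀ ⊕ₛ ((a ⊖ 1) + b), where x ⊕ₛ d is the sum with the
-- one-term sequence (x), given entrywise by (x ⊕ dₙ) ⊙ dₙ₋₁ (with d₋₁ = 1).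
-- Closure under +, associativity and distributivity over ∨ and ∧ therefore
-- follow by induction on N from three properties of ⊕ₛ: it preserves good
-- chains, (x ⊕ y) ⊕ₛ ((x ⊙ y) ⊕ₛ d) = x ⊕ₛ (y ⊕ₛ d), and it commutes with ∨ and ∧
-- on good chains. Entrywise these are identities about good pairs (u, v), mostly
-- driven by the interchange law (z ⊕ v) ⊙ u = (z ⊙ u) ⊕ v, which follows from
-- ax1 and ax2. Commutativity comes from reversing the product defining +, and
-- the lattice laws hold pointwise.
module Submission where

open import Defs
open import Level using (0ℓ)
open import Data.Product using (Σ; ∃; _,_; proj₁; proj₂)
open import Data.Nat using (ℕ; zero; suc; 2+; _+_; _∸_; z≤n; s≤s) renaming (_≤_ to _≤ℕ_; _<_ to _<ℕ_)
import Data.Nat.Properties as ℕ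
open import Relation.Nullary using (yes; no)
open import Relation.Binary.PropositionalEquality
open import Relation.Binary.Bundles using (Setoid)
import Relation.Binary.Construct.On as On
import Relation.Binary.Lattice as OrderTheoretic
import Relation.Binary.Reasoning.Setoid as SetoidReasoning
open import Algebra.Core using (Op₂)
open import Algebra.Structures using (IsCommutativeMonoid)
open import Algebra.Lattice.Bundles using (Lattice)
open import Algebra.Lattice.Structures using (IsDistributiveLattice)
import Algebra.Lattice.Properties.Lattice as LatticeProperties
import Algebra.Consequences.Setoid as AlgebraConsequences

module MVMonoidalProperties (A : MVMonoidal) where
  open MVMonoidal A
  open IsDistributiveLattice isDistributiveLattice public
    using (isLattice; ∨-comm; ∨-assoc; ∧-comm; ∧-assoc; ∨-absorbs-∧; ∧-absorbs-∨; ∨-distrib-∧; ∧-distrib-∨)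
  open IsCommutativeMonoid ⊕-isCommutativeMonoid public
    using () renaming (assoc to ⊕-assoc; comm to ⊕-comm; identityˡ to ⊕-identityˡ; identityʳ to ⊕-identityʳ)
  open IsCommutativeMonoid ⊙-isCommutativeMonoid public
    using () renaming (assoc to ⊙-assoc; comm to ⊙-comm; identityˡ to ⊙-identityˡ; identityʳ to ⊙-identityʳ)

  lattice : Lattice 0ℓ 0ℓ
  lattice = record { isLattice = isLattice }

  open LatticeProperties lattice public using (∨-idem; ∧-idem; ∨-∧-orderTheoreticLattice)
  -- x ≤ y unfolds to x ≡ x ∧ y; several proofs below use this directly.
  open OrderTheoretic.Lattice ∨-∧-orderTheoreticLattice public
    using (_≤_; x≤x∨y; y≤x∨y; ∨-least; x∧y≤x; x∧y≤y; ∧-greatest)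
    renaming (refl to ≤-refl; reflexive to ≤-reflexive; trans to ≤-trans; antisym to ≤-antisym)

  ⊕-monoʳ-≤ : ∀ x {y z} → y ≤ z → x ⊕ y ≤ x ⊕ z
  ⊕-monoʳ-≤ x {y} {z} y≤z = trans (cong (x ⊕_) y≤z) (proj₁ ⊕-distrib-∧ x y z)

  ⊙-monoʳ-≤ : ∀ x {y z} → y ≤ z → x ⊙ y ≤ x ⊙ z
  ⊙-monoʳ-≤ x {y} {z} y≤z = trans (cong (x ⊙_) y≤z) (proj₁ ⊙-distrib-∧ x y z)

  ⊙-monoˡ-≤ : ∀ x {y z} → y ≤ z → y ⊙ x ≤ z ⊙ x
  ⊙-monoˡ-≤ x {y} {z} y≤z = trans (cong (_⊙ x) y≤z) (proj₂ ⊙-distrib-∧ x y z)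

  ⊙-mono-≤ : ∀ {x x′ y y′} → x ≤ x′ → y ≤ y′ → x ⊙ y ≤ x′ ⊙ y′
  ⊙-mono-≤ {x′ = x′} {y} x≤x′ y≤y′ = ≤-trans (⊙-monoˡ-≤ y x≤x′) (⊙-monoʳ-≤ x′ y≤y′)

  -- Instances of ax3 with y := 𝟙 and of ax4 with y := 𝟘.
  y≤x⊕y : ∀ x y → y ≤ x ⊕ y
  y≤x⊕y x y = subst (y ≤_) (sym (trans (cong (_⊕ y) (sym (⊙-identityʳ x))) (ax3 x 𝟙 y))) (y≤x∨y _ y)

  x⊙y≤y : ∀ x y → x ⊙ y ≤ y
  x⊙y≤y x y = subst (_≤ y) (sym (trans (cong (_⊙ y) (sym (⊕-identityʳ x))) (ax4 x 𝟘 y))) (x∧y≤y _ y)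

  x≤x⊕y : ∀ x y → x ≤ x ⊕ y
  x≤x⊕y x y = subst (x ≤_) (⊕-comm y x) (y≤x⊕y y x)

  x⊙y≤x : ∀ x y → x ⊙ y ≤ x
  x⊙y≤x x y = subst (_≤ x) (⊙-comm y x) (x⊙y≤y y x)

  𝟘-minimum : ∀ x → 𝟘 ≤ x
  𝟘-minimum x = subst (𝟘 ≤_) (⊕-identityʳ x) (y≤x⊕y x 𝟘)

  𝟙-maximum : ∀ x → x ≤ 𝟙
  𝟙-maximum x = subst (_≤ 𝟙) (⊙-identityʳ x) (x⊙y≤y x 𝟙)

  ⊕-zeroʳ : ∀ x → x ⊕ 𝟙 ≡ 𝟙
  ⊕-zeroʳ x = ≤-antisym (𝟙-maximum _) (y≤x⊕y x 𝟙)

  ⊕-zeroˡ : ∀ x → 𝟙 ⊕ x ≡ 𝟙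
  ⊕-zeroˡ x = trans (⊕-comm 𝟙 x) (⊕-zeroʳ x)

  ⊙-zeroʳ : ∀ x → x ⊙ 𝟘 ≡ 𝟘
  ⊙-zeroʳ x = ≤-antisym (x⊙y≤y x 𝟘) (𝟘-minimum _)

  ∨-zeroʳ : ∀ x → x ∨ 𝟙 ≡ 𝟙
  ∨-zeroʳ x = ≤-antisym (∨-least (𝟙-maximum x) ≤-refl) (y≤x∨y x 𝟙)

  ∨-identityʳ : ∀ x → x ∨ 𝟘 ≡ x
  ∨-identityʳ x = ≤-antisym (∨-least ≤-refl (𝟘-minimum x)) (x≤x∨y x 𝟘)

  open GoodSequences A using (IsGoodPair)

  module _ {u v : Carrier} (g : IsGoodPair u v) where
    private
      u⊕v≡u : u ⊕ v ≡ u
      u⊕v≡u = proj₁ g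
      u⊙v≡v : u ⊙ v ≡ v
      u⊙v≡v = proj₂ g

    good-⊕-split : ∀ z → v ⊕ z ≡ (u ⊙ (v ⊕ z)) ∨ z
    good-⊕-split z = begin
      v ⊕ z                            ≡⟨ cong (_⊕ z) u⊙v≡v ⟨
      (u ⊙ v) ⊕ z                      ≡⟨ ax3 u v z ⟩
      ((u ⊕ v) ⊙ ((u ⊙ v) ⊕ z)) ∨ z    ≡⟨ cong₂ (λ s p → (s ⊙ (p ⊕ z)) ∨ z) u⊕v≡u u⊙v≡v ⟩
      (u ⊙ (v ⊕ z)) ∨ z                ∎
      where open ≡-Reasoning

    good-⊙-split : ∀ z → u ⊙ z ≡ (v ⊕ (u ⊙ z)) ∧ z
    good-⊙-split z = begin
      u ⊙ z                            ≡⟨ cong (_⊙ z) u⊕v≡u ⟨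
      (u ⊕ v) ⊙ z                      ≡⟨ ax4 u v z ⟩
      ((u ⊙ v) ⊕ ((u ⊕ v) ⊙ z)) ∧ z    ≡⟨ cong₂ (λ p s → (p ⊕ (s ⊙ z)) ∧ z) u⊙v≡v u⊕v≡u ⟩
      (v ⊕ (u ⊙ z)) ∧ z                ∎
      where open ≡-Reasoning

    good-⊕-≤ : ∀ z → v ⊕ z ≤ u ∨ z
    good-⊕-≤ z = subst (_≤ u ∨ z) (sym (good-⊕-split z))
      (∨-least (≤-trans (x⊙y≤x u _) (x≤x∨y u z)) (y≤x∨y u z))

    good-⊙-≥ : ∀ z → v ∧ z ≤ u ⊙ z
    good-⊙-≥ z = subst (v ∧ z ≤_) (sym (good-⊙-split z))
      (∧-greatest (≤-trans (x∧y≤x v z) (x≤x⊕y v _)) (x∧y≤y v z))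

    good-raiseˡ : ∀ {w} → u ≤ w → IsGoodPair w v
    good-raiseˡ {w} u≤w = ≤-antisym w⊕v≤w (x≤x⊕y w v) , ≤-antisym (x⊙y≤y w v) v≤w⊙v
      where
      w⊕v≤w : w ⊕ v ≤ w
      w⊕v≤w = subst (_≤ w) (⊕-comm v w) (≤-trans (good-⊕-≤ w) (∨-least u≤w ≤-refl))
      v≤w⊙v : v ≤ w ⊙ v
      v≤w⊙v = subst (_≤ w ⊙ v) u⊙v≡v (⊙-monoˡ-≤ v u≤w)

    good-interchange : ∀ z → (z ⊕ v) ⊙ u ≡ (z ⊙ u) ⊕ v
    good-interchange z = ≤-antisym lhs≤rhs rhs≤lhs
      where
      open ≡-Reasoning
      ax2-instance : (z ⊙ u) ⊕ ((z ⊕ u) ⊙ v) ≡ (z ⊕ v) ⊙ u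
      ax2-instance = begin
        (z ⊙ u) ⊕ ((z ⊕ u) ⊙ v) ≡⟨ ax2 z u v ⟩
        (z ⊕ (u ⊙ v)) ⊙ (u ⊕ v) ≡⟨ cong₂ (λ p s → (z ⊕ p) ⊙ s) u⊙v≡v u⊕v≡u ⟩
        (z ⊕ v) ⊙ u             ∎
      ax1-instance : (z ⊕ v) ⊙ ((z ⊙ v) ⊕ u) ≡ (z ⊙ u) ⊕ v
      ax1-instance = begin
        (z ⊕ v) ⊙ ((z ⊙ v) ⊕ u) ≡⟨ ax1 z v u ⟩
        (z ⊙ (v ⊕ u)) ⊕ (v ⊙ u) ≡⟨ cong₂ (λ s p → (z ⊙ s) ⊕ p)
                                         (trans (⊕-comm v u) u⊕v≡u) (trans (⊙-comm v u) u⊙v≡v) ⟩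
        (z ⊙ u) ⊕ v             ∎
      rhs≤lhs : (z ⊙ u) ⊕ v ≤ (z ⊕ v) ⊙ u
      rhs≤lhs = subst ((z ⊙ u) ⊕ v ≤_) ax2-instance
        (⊕-monoʳ-≤ (z ⊙ u) (subst (_≤ (z ⊕ u) ⊙ v) u⊙v≡v (⊙-monoˡ-≤ v (y≤x⊕y z u))))
      lhs≤rhs : (z ⊕ v) ⊙ u ≤ (z ⊙ u) ⊕ v
      lhs≤rhs = subst ((z ⊕ v) ⊙ u ≤_) ax1-instance (⊙-monoʳ-≤ (z ⊕ v) (y≤x⊕y (z ⊙ v) u))

  ⊕-⊙-good : ∀ x y → IsGoodPair (x ⊕ y) (x ⊙ y)
  ⊕-⊙-good x y = absorbs-⊙ , absorbed-by-⊕
    where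
    open ≡-Reasoning
    absorbs-⊙ : (x ⊕ y) ⊕ (x ⊙ y) ≡ x ⊕ y
    absorbs-⊙ = begin
      (x ⊕ y) ⊕ (x ⊙ y)         ≡⟨ ⊕-comm _ _ ⟩
      (x ⊙ y) ⊕ (x ⊕ y)         ≡⟨ cong ((x ⊙ y) ⊕_) (⊙-identityʳ _) ⟨
      (x ⊙ y) ⊕ ((x ⊕ y) ⊙ 𝟙)   ≡⟨ ax2 x y 𝟙 ⟩
      (x ⊕ (y ⊙ 𝟙)) ⊙ (y ⊕ 𝟙)   ≡⟨ cong₂ (λ p s → (x ⊕ p) ⊙ s) (⊙-identityʳ y) (⊕-zeroʳ y) ⟩
      (x ⊕ y) ⊙ 𝟙               ≡⟨ ⊙-identityʳ _ ⟩
      x ⊕ y                     ∎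
    absorbed-by-⊕ : (x ⊕ y) ⊙ (x ⊙ y) ≡ x ⊙ y
    absorbed-by-⊕ = begin
      (x ⊕ y) ⊙ (x ⊙ y)         ≡⟨ cong ((x ⊕ y) ⊙_) (⊕-identityʳ _) ⟨
      (x ⊕ y) ⊙ ((x ⊙ y) ⊕ 𝟘)   ≡⟨ ax1 x y 𝟘 ⟩
      (x ⊙ (y ⊕ 𝟘)) ⊕ (y ⊙ 𝟘)   ≡⟨ cong₂ (λ s p → (x ⊙ s) ⊕ p) (⊕-identityʳ y) (⊙-zeroʳ y) ⟩
      (x ⊙ y) ⊕ 𝟘               ≡⟨ ⊕-identityʳ _ ⟩
      x ⊙ y                     ∎

  good-lowerʳ : ∀ {u v v′} → IsGoodPair u v → v′ ≤ v → IsGoodPair u v′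
  good-lowerʳ {u} {v} {v′} g@(u⊕v≡u , _) v′≤v =
    ≤-antisym (subst (u ⊕ v′ ≤_) u⊕v≡u (⊕-monoʳ-≤ u v′≤v)) (x≤x⊕y u v′) ,
    ≤-antisym (x⊙y≤y u v′) (subst (_≤ u ⊙ v′) (trans (∧-comm v v′) (sym v′≤v)) (good-⊙-≥ g v′))

  good-∨ʳ : ∀ {u v v′} → IsGoodPair u v → IsGoodPair u v′ → IsGoodPair u (v ∨ v′)
  good-∨ʳ {u} {v} {v′} (u⊕v≡u , u⊙v≡v) (u⊕v′≡u , u⊙v′≡v′) =
    trans (proj₁ ⊕-distrib-∨ u v v′) (trans (cong₂ _∨_ u⊕v≡u u⊕v′≡u) (∨-idem u)) ,
    trans (proj₁ ⊙-distrib-∨ u v v′) (cong₂ _∨_ u⊙v≡v u⊙v′≡v′)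

  good-∧ˡ : ∀ {u u′ v} → IsGoodPair u v → IsGoodPair u′ v → IsGoodPair (u ∧ u′) v
  good-∧ˡ {u} {u′} {v} (u⊕v≡u , u⊙v≡v) (u′⊕v≡u′ , u′⊙v≡v) =
    trans (proj₂ ⊕-distrib-∧ v u u′) (cong₂ _∧_ u⊕v≡u u′⊕v≡u′) ,
    trans (proj₂ ⊙-distrib-∧ v u u′) (trans (cong₂ _∧_ u⊙v≡v u′⊙v≡v) (∧-idem v))

  ∨-good : ∀ {u v u′ v′} → IsGoodPair u v → IsGoodPair u′ v′ → IsGoodPair (u ∨ u′) (v ∨ v′)
  ∨-good {u} {v} {u′} {v′} g g′ = good-∨ʳ (good-raiseˡ g (x≤x∨y u u′)) (good-raiseˡ g′ (y≤x∨y u u′))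

  ∧-good : ∀ {u v u′ v′} → IsGoodPair u v → IsGoodPair u′ v′ → IsGoodPair (u ∧ u′) (v ∧ v′)
  ∧-good {u} {v} {u′} {v′} g g′ = good-∧ˡ (good-lowerʳ g (x∧y≤x v v′)) (good-lowerʳ g′ (x∧y≤y v v′))

  good-cross-∨ : ∀ {u v} → IsGoodPair u v → ∀ x z → (x ⊕ v) ⊙ z ≤ ((x ⊕ v) ⊙ u) ∨ (x ⊙ z)
  good-cross-∨ {u} {v} g x z = subst (_≤ ((x ⊕ v) ⊙ u) ∨ (x ⊙ z)) (sym split)
    (∨-least (≤-trans (x⊙y≤x _ z) (≤-trans (≤-reflexive (⊙-comm u _)) (x≤x∨y _ _))) (y≤x∨y _ _))
    where
    split : (x ⊕ v) ⊙ z ≡ ((u ⊙ (x ⊕ v)) ⊙ z) ∨ (x ⊙ z)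
    split = trans (cong (_⊙ z) (trans (⊕-comm x v) (trans (good-⊕-split g x) (cong (λ s → (u ⊙ s) ∨ x) (⊕-comm v x)))))
                  (proj₂ ⊙-distrib-∨ z _ x)

  good-cross-∧ : ∀ {u v x y} → IsGoodPair u v → x ≤ y → y ∧ ((x ⊕ v) ⊙ u) ≤ y ⊙ u
  good-cross-∧ {u} {v} {x} {y} g x≤y = subst (y ∧ ((x ⊕ v) ⊙ u) ≤_) (sym split)
    (∧-greatest bound (x∧y≤x y _))
    where
    split : y ⊙ u ≡ (v ⊕ (u ⊙ y)) ∧ y
    split = trans (⊙-comm y u) (good-⊙-split g y)
    bound : y ∧ ((x ⊕ v) ⊙ u) ≤ v ⊕ (u ⊙ y)
    bound = ≤-trans (x∧y≤y y _) (subst (_≤ v ⊕ (u ⊙ y))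
      (sym (trans (good-interchange g x) (⊕-comm _ v)))
      (⊕-monoʳ-≤ v (subst (_≤ u ⊙ y) (⊙-comm u x) (⊙-monoʳ-≤ u x≤y))))

  ⊕⊙-distrib-∨ : ∀ {u v u′ v′} → IsGoodPair u v → IsGoodPair u′ v′ → ∀ x →
                 (x ⊕ (v ∨ v′)) ⊙ (u ∨ u′) ≡ ((x ⊕ v) ⊙ u) ∨ ((x ⊕ v′) ⊙ u′)
  ⊕⊙-distrib-∨ {u} {v} {u′} {v′} g g′ x = ≤-antisym (subst (_≤ R) (sym expand) four-terms≤R)
    (∨-least (⊙-mono-≤ (⊕-monoʳ-≤ x (x≤x∨y v v′)) (x≤x∨y u u′))
             (⊙-mono-≤ (⊕-monoʳ-≤ x (y≤x∨y v v′)) (y≤x∨y u u′)))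
    where
    R : Carrier
    R = ((x ⊕ v) ⊙ u) ∨ ((x ⊕ v′) ⊙ u′)
    expand : (x ⊕ (v ∨ v′)) ⊙ (u ∨ u′) ≡
             (((x ⊕ v) ⊙ u) ∨ ((x ⊕ v′) ⊙ u)) ∨ (((x ⊕ v) ⊙ u′) ∨ ((x ⊕ v′) ⊙ u′))
    expand = trans (cong (_⊙ (u ∨ u′)) (proj₁ ⊕-distrib-∨ x v v′))
      (trans (proj₁ ⊙-distrib-∨ _ u u′) (cong₂ _∨_ (proj₂ ⊙-distrib-∨ u _ _) (proj₂ ⊙-distrib-∨ u′ _ _)))
    cross : ∀ {u v u′ v′} → IsGoodPair u v → (x ⊕ v) ⊙ u′ ≤ ((x ⊕ v) ⊙ u) ∨ ((x ⊕ v′) ⊙ u′)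
    cross {u} {v} {u′} {v′} g = ≤-trans (good-cross-∨ g x u′)
      (∨-least (x≤x∨y _ _) (≤-trans (⊙-monoˡ-≤ u′ (x≤x⊕y x v′)) (y≤x∨y _ _)))
    four-terms≤R : (((x ⊕ v) ⊙ u) ∨ ((x ⊕ v′) ⊙ u)) ∨ (((x ⊕ v) ⊙ u′) ∨ ((x ⊕ v′) ⊙ u′)) ≤ R
    four-terms≤R = ∨-least (∨-least (x≤x∨y _ _) (subst ((x ⊕ v′) ⊙ u ≤_) (∨-comm _ _) (cross g′)))
                           (∨-least (cross g) (y≤x∨y _ _))

  ⊕⊙-distrib-∧ : ∀ {u v u′ v′} → IsGoodPair u v → IsGoodPair u′ v′ → ∀ x →
                 (x ⊕ (v ∧ v′)) ⊙ (u ∧ u′) ≡ ((x ⊕ v) ⊙ u) ∧ ((x ⊕ v′) ⊙ u′)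
  ⊕⊙-distrib-∧ {u} {v} {u′} {v′} g g′ x = ≤-antisym
    (∧-greatest (⊙-mono-≤ (⊕-monoʳ-≤ x (x∧y≤x v v′)) (x∧y≤x u u′))
                (⊙-mono-≤ (⊕-monoʳ-≤ x (x∧y≤y v v′)) (x∧y≤y u u′)))
    (subst (R ≤_) (sym expand) R≤four-terms)
    where
    R : Carrier
    R = ((x ⊕ v) ⊙ u) ∧ ((x ⊕ v′) ⊙ u′)
    expand : (x ⊕ (v ∧ v′)) ⊙ (u ∧ u′) ≡
             (((x ⊕ v) ⊙ u) ∧ ((x ⊕ v′) ⊙ u)) ∧ (((x ⊕ v) ⊙ u′) ∧ ((x ⊕ v′) ⊙ u′))
    expand = trans (cong (_⊙ (u ∧ u′)) (proj₁ ⊕-distrib-∧ x v v′))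
      (trans (proj₁ ⊙-distrib-∧ _ u u′) (cong₂ _∧_ (proj₂ ⊙-distrib-∧ u _ _) (proj₂ ⊙-distrib-∧ u′ _ _)))
    cross : ∀ {u v u′ v′} → IsGoodPair u′ v′ → ((x ⊕ v) ⊙ u) ∧ ((x ⊕ v′) ⊙ u′) ≤ (x ⊕ v) ⊙ u′
    cross {u} {v} g′ = ≤-trans (∧-greatest (≤-trans (x∧y≤x _ _) (x⊙y≤x _ u)) (x∧y≤y _ _))
                               (good-cross-∧ g′ (x≤x⊕y x v))
    R≤four-terms : R ≤ (((x ⊕ v) ⊙ u) ∧ ((x ⊕ v′) ⊙ u)) ∧ (((x ⊕ v) ⊙ u′) ∧ ((x ⊕ v′) ⊙ u′))
    R≤four-terms = ∧-greatest (∧-greatest (x∧y≤x _ _) (subst (_≤ (x ⊕ v′) ⊙ u) (∧-comm _ _) (cross g)))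
                              (∧-greatest (cross g′) (x∧y≤y _ _))

  ⊕⊙-good-step : ∀ {p q r} → IsGoodPair p q → IsGoodPair q r → ∀ x → IsGoodPair ((x ⊕ q) ⊙ p) ((x ⊕ r) ⊙ q)
  ⊕⊙-good-step {p} {q} {r} gpq gqr x = s⊕t≡s , s⊙t≡t
    where
    open ≡-Reasoning
    s t : Carrier
    s = (x ⊕ q) ⊙ p
    t = (x ⊕ r) ⊙ q
    s⊙t≡t : s ⊙ t ≡ t
    s⊙t≡t = begin
      ((x ⊕ q) ⊙ p) ⊙ ((x ⊕ r) ⊙ q) ≡⟨ ⊙-assoc _ _ _ ⟩
      (x ⊕ q) ⊙ (p ⊙ ((x ⊕ r) ⊙ q)) ≡⟨ cong ((x ⊕ q) ⊙_)
                                         (trans (cong (p ⊙_) (⊙-comm _ q)) (sym (⊙-assoc p q _))) ⟩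
      (x ⊕ q) ⊙ ((p ⊙ q) ⊙ (x ⊕ r)) ≡⟨ cong (λ w → (x ⊕ q) ⊙ (w ⊙ (x ⊕ r))) (proj₂ gpq) ⟩
      (x ⊕ q) ⊙ (q ⊙ (x ⊕ r))       ≡⟨ cong ((x ⊕ q) ⊙_) (trans (⊙-comm q _) (good-interchange gqr x)) ⟩
      (x ⊕ q) ⊙ ((x ⊙ q) ⊕ r)       ≡⟨ ax1 x q r ⟩
      (x ⊙ (q ⊕ r)) ⊕ (q ⊙ r)       ≡⟨ cong₂ (λ s′ t′ → (x ⊙ s′) ⊕ t′) (proj₁ gqr) (proj₂ gqr) ⟩
      (x ⊙ q) ⊕ r                   ≡⟨ good-interchange gqr x ⟨
      t                             ∎
    s⊕x⊙q≡s : s ⊕ (x ⊙ q) ≡ s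
    s⊕x⊙q≡s = begin
      s ⊕ (x ⊙ q)                   ≡⟨ ⊕-comm _ _ ⟩
      (x ⊙ q) ⊕ ((x ⊕ q) ⊙ p)       ≡⟨ ax2 x q p ⟩
      (x ⊕ (q ⊙ p)) ⊙ (q ⊕ p)       ≡⟨ cong₂ (λ s′ t′ → (x ⊕ s′) ⊙ t′)
                                         (trans (⊙-comm q p) (proj₂ gpq)) (trans (⊕-comm q p) (proj₁ gpq)) ⟩
      s                             ∎
    q≤s : q ≤ s
    q≤s = subst (_≤ s) (trans (⊙-comm q p) (proj₂ gpq)) (⊙-monoˡ-≤ p (y≤x⊕y x q))
    s⊕t≡s : s ⊕ t ≡ s
    s⊕t≡s = begin
      s ⊕ ((x ⊕ r) ⊙ q)             ≡⟨ cong (s ⊕_) (good-interchange gqr x) ⟩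
      s ⊕ ((x ⊙ q) ⊕ r)             ≡⟨ ⊕-assoc _ _ _ ⟨
      (s ⊕ (x ⊙ q)) ⊕ r             ≡⟨ cong (_⊕ r) s⊕x⊙q≡s ⟩
      s ⊕ r                         ≡⟨ proj₁ (good-raiseˡ gqr q≤s) ⟩
      s                             ∎

  ⊕⊙-nested : ∀ {q r} → IsGoodPair q r → ∀ x y →
              ((x ⊕ y) ⊕ (((x ⊙ y) ⊕ r) ⊙ q)) ⊙ ((x ⊙ y) ⊕ q) ≡ (x ⊕ ((y ⊕ r) ⊙ q)) ⊙ (y ⊕ q)
  ⊕⊙-nested {q} {r} g x y = begin
    (S ⊕ ((P ⊕ r) ⊙ q)) ⊙ (P ⊕ q)      ≡⟨ cong (λ w → (S ⊕ w) ⊙ (P ⊕ q)) (good-interchange g P) ⟩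
    (S ⊕ ((P ⊙ q) ⊕ r)) ⊙ (P ⊕ q)      ≡⟨ cong (_⊙ (P ⊕ q)) (⊕-assoc _ _ _) ⟨
    ((S ⊕ (P ⊙ q)) ⊕ r) ⊙ (P ⊕ q)      ≡⟨ good-interchange g′ _ ⟩
    ((S ⊕ (P ⊙ q)) ⊙ (P ⊕ q)) ⊕ r      ≡⟨ cong (_⊕ r) ax1-instance ⟩
    (P ⊕ (S ⊙ q)) ⊕ r                  ≡⟨ cong (_⊕ r) (ax2 x y q) ⟩
    ((x ⊕ (y ⊙ q)) ⊙ (y ⊕ q)) ⊕ r      ≡⟨ good-interchange (good-raiseˡ g (y≤x⊕y y q)) _ ⟨
    ((x ⊕ (y ⊙ q)) ⊕ r) ⊙ (y ⊕ q)      ≡⟨ cong (_⊙ (y ⊕ q)) (⊕-assoc _ _ _) ⟩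
    (x ⊕ ((y ⊙ q) ⊕ r)) ⊙ (y ⊕ q)      ≡⟨ cong (λ w → (x ⊕ w) ⊙ (y ⊕ q)) (good-interchange g y) ⟨
    (x ⊕ ((y ⊕ r) ⊙ q)) ⊙ (y ⊕ q)      ∎
    where
    open ≡-Reasoning
    S P : Carrier
    S = x ⊕ y
    P = x ⊙ y
    g′ : IsGoodPair (P ⊕ q) r
    g′ = good-raiseˡ g (y≤x⊕y P q)
    ax1-instance : (S ⊕ (P ⊙ q)) ⊙ (P ⊕ q) ≡ P ⊕ (S ⊙ q)
    ax1-instance = begin
      (S ⊕ (P ⊙ q)) ⊙ (P ⊕ q)   ≡⟨ ⊙-comm _ _ ⟩
      (P ⊕ q) ⊙ (S ⊕ (P ⊙ q))   ≡⟨ cong ((P ⊕ q) ⊙_) (⊕-comm _ _) ⟩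
      (P ⊕ q) ⊙ ((P ⊙ q) ⊕ S)   ≡⟨ ax1 P q S ⟩
      (P ⊙ (q ⊕ S)) ⊕ (q ⊙ S)   ≡⟨ cong₂ _⊕_ (trans (⊙-comm _ _) (proj₂ (good-raiseˡ (⊕-⊙-good x y) (y≤x⊕y q S))))
                                             (⊙-comm _ _) ⟩
      P ⊕ (S ⊙ q)               ∎

module GoodSequenceProperties (A : MVMonoidal) where
  open MVMonoidal A
  open MVMonoidalProperties A
  open GoodSequences A

  module ≗-Reasoning = SetoidReasoning (ℕ →-setoid Carrier)
  open Setoid (ℕ →-setoid Carrier) using () renaming (sym to ≗-sym; trans to ≗-trans)

  IsGoodChain : Seq → Set
  IsGoodChain a = ∀ n → IsGoodPair (a n) (a (suc n))

  VanishesFrom : ℕ → Seq → Set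
  VanishesFrom N a = ∀ n → N ≤ℕ n → a n ≡ 𝟘

  chain-resp-≗ : ∀ {a b} → a ≗ b → IsGoodChain a → IsGoodChain b
  chain-resp-≗ a≗b ga n = subst₂ IsGoodPair (a≗b n) (a≗b (suc n)) (ga n)

  vanishes-resp-≗ : ∀ {N a b} → a ≗ b → VanishesFrom N a → VanishesFrom N b
  vanishes-resp-≗ a≗b va n N≤n = trans (sym (a≗b n)) (va n N≤n)

  minusOne-chain : ∀ {a} → IsGoodChain a → IsGoodChain (minusOneSeq a)
  minusOne-chain ga n = ga (suc n)

  minusOne-vanishes : ∀ {N a} → VanishesFrom (suc N) a → VanishesFrom N (minusOneSeq a)
  minusOne-vanishes va n N≤n = va (suc n) (s≤s N≤n)

  vanishes-from-0 : ∀ {a} → VanishesFrom 0 a → a ≗ zeroSeq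
  vanishes-from-0 va n = va n z≤n

  chain-≤-head : ∀ {a} → IsGoodChain a → ∀ n → a n ≤ a 0
  chain-≤-head ga zero = ≤-refl
  chain-≤-head ga (suc n) = ≤-trans (subst (_≤ _) (proj₂ (ga n)) (x⊙y≤x _ _)) (chain-≤-head ga n)

  _∷ₛ_ : Carrier → Seq → Seq
  (x ∷ₛ a) zero = x
  (x ∷ₛ a) (suc n) = a n

  ∷ₛ-chain : ∀ {x a} → IsGoodPair x (a 0) → IsGoodChain a → IsGoodChain (x ∷ₛ a)
  ∷ₛ-chain g ga zero = g
  ∷ₛ-chain g ga (suc n) = ga n

  𝟙∷ₛ-chain : ∀ {a} → IsGoodChain a → IsGoodChain (𝟙 ∷ₛ a)
  𝟙∷ₛ-chain = ∷ₛ-chain (⊕-zeroˡ _ , ⊙-identityˡ _)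

  ∷ₛ𝟘-chain : ∀ x → IsGoodChain (x ∷ₛ zeroSeq)
  ∷ₛ𝟘-chain x = ∷ₛ-chain (⊕-identityʳ x , ⊙-zeroʳ x) (λ _ → ⊕-identityʳ 𝟘 , ⊙-zeroʳ 𝟘)

  _⊕ₛ_ : Carrier → Seq → Seq
  (x ⊕ₛ a) n = (x ⊕ a n) ⊙ (𝟙 ∷ₛ a) n

  ⊕ₛ-cong : ∀ {x y a b} → x ≡ y → a ≗ b → x ⊕ₛ a ≗ y ⊕ₛ b
  ⊕ₛ-cong {x} refl a≗b zero = cong (λ t → (x ⊕ t) ⊙ 𝟙) (a≗b zero)
  ⊕ₛ-cong {x} refl a≗b (suc n) = cong₂ (λ s t → (x ⊕ s) ⊙ t) (a≗b (suc n)) (a≗b n)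

  ⊕ₛ-congʳ : ∀ x {a b} → a ≗ b → x ⊕ₛ a ≗ x ⊕ₛ b
  ⊕ₛ-congʳ x = ⊕ₛ-cong refl

  𝟙⊕ₛ : ∀ a → 𝟙 ⊕ₛ a ≗ 𝟙 ∷ₛ a
  𝟙⊕ₛ a zero = trans (⊙-identityʳ _) (⊕-zeroˡ _)
  𝟙⊕ₛ a (suc n) = trans (cong (_⊙ a n) (⊕-zeroˡ _)) (⊙-identityˡ _)

  ⊕ₛ-vanishes : ∀ {N a} → VanishesFrom N a → ∀ x → VanishesFrom (suc N) (x ⊕ₛ a)
  ⊕ₛ-vanishes {a = a} va x (suc n) (s≤s N≤n) = trans (cong ((x ⊕ a (suc n)) ⊙_) (va n N≤n)) (⊙-zeroʳ _)

  ⊕ₛ-chain : ∀ {a} → IsGoodChain a → ∀ x → IsGoodChain (x ⊕ₛ a)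
  ⊕ₛ-chain ga x n = ⊕⊙-good-step (𝟙∷ₛ-chain ga n) (ga n) x

  ⊙-upTo-cong : ∀ {f g} n → (∀ i → i ≤ℕ n → f i ≡ g i) → ⊙-upTo f n ≡ ⊙-upTo g n
  ⊙-upTo-cong zero f≡g = f≡g zero z≤n
  ⊙-upTo-cong (suc n) f≡g =
    cong₂ _⊙_ (⊙-upTo-cong n (λ i i≤n → f≡g i (ℕ.m≤n⇒m≤1+n i≤n))) (f≡g (suc n) ℕ.≤-refl)

  ⊙-upTo-mono-≤ : ∀ {f g} n → (∀ i → i ≤ℕ n → f i ≤ g i) → ⊙-upTo f n ≤ ⊙-upTo g n
  ⊙-upTo-mono-≤ zero f≤g = f≤g zero z≤n
  ⊙-upTo-mono-≤ (suc n) f≤g =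
    ⊙-mono-≤ (⊙-upTo-mono-≤ n (λ i i≤n → f≤g i (ℕ.m≤n⇒m≤1+n i≤n))) (f≤g (suc n) ℕ.≤-refl)

  ⊙-upTo-unconsˡ : ∀ f n → ⊙-upTo f (suc n) ≡ f 0 ⊙ ⊙-upTo (λ i → f (suc i)) n
  ⊙-upTo-unconsˡ f zero = refl
  ⊙-upTo-unconsˡ f (suc n) = trans (cong (_⊙ f (suc (suc n))) (⊙-upTo-unconsˡ f n)) (⊙-assoc _ _ _)

  ⊙-upTo-reverse : ∀ f n → ⊙-upTo f n ≡ ⊙-upTo (λ i → f (n ∸ i)) n
  ⊙-upTo-reverse f zero = refl
  ⊙-upTo-reverse f (suc n) = begin
    ⊙-upTo f (suc n)                                ≡⟨ ⊙-upTo-unconsˡ f n ⟩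
    f 0 ⊙ ⊙-upTo (λ i → f (suc i)) n                ≡⟨ cong (f 0 ⊙_) (⊙-upTo-reverse (λ i → f (suc i)) n) ⟩
    f 0 ⊙ ⊙-upTo (λ i → f (suc (n ∸ i))) n          ≡⟨ ⊙-comm _ _ ⟩
    ⊙-upTo (λ i → f (suc (n ∸ i))) n ⊙ f 0          ≡⟨ cong₂ _⊙_ (⊙-upTo-cong n (λ i i≤n → cong f (sym (ℕ.+-∸-assoc 1 i≤n))))
                                                                (cong f (sym (ℕ.n∸n≡0 n))) ⟩
    ⊙-upTo (λ i → f (suc n ∸ i)) (suc n)            ∎
    where open ≡-Reasoning

  ⊙-upTo-chain : ∀ {a} → IsGoodChain a → ∀ n → ⊙-upTo a n ≡ a n
  ⊙-upTo-chain ga zero = refl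
  ⊙-upTo-chain ga (suc n) = trans (cong (_⊙ _) (⊙-upTo-chain ga n)) (proj₂ (ga n))

  ⊙-upTo-chain-reversed : ∀ {a} → IsGoodChain a → ∀ n → ⊙-upTo (λ i → a (n ∸ i)) n ≡ a n
  ⊙-upTo-chain-reversed {a} ga n = trans (sym (⊙-upTo-reverse a n)) (⊙-upTo-chain ga n)

  plus-cong : ∀ {a a′ b b′} → a ≗ a′ → b ≗ b′ → plusSeq a b ≗ plusSeq a′ b′
  plus-cong a≗a′ b≗b′ n = ⊙-upTo-cong n (λ i _ → cong₂ _⊕_ (a≗a′ i) (b≗b′ (n ∸ i)))

  plus-congˡ : ∀ {a a′} b → a ≗ a′ → plusSeq a b ≗ plusSeq a′ b
  plus-congˡ b a≗a′ = plus-cong {b = b} a≗a′ (λ _ → refl)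

  plus-comm : ∀ a b → plusSeq a b ≗ plusSeq b a
  plus-comm a b n = trans (⊙-upTo-reverse _ n)
    (⊙-upTo-cong n (λ i i≤n → trans (⊕-comm _ _) (cong (λ k → b k ⊕ a (n ∸ i)) (ℕ.m∸[m∸n]≡n i≤n))))

  plus-identityˡ : ∀ {b} → IsGoodChain b → plusSeq zeroSeq b ≗ b
  plus-identityˡ gb n = trans (⊙-upTo-cong n (λ i _ → ⊕-identityˡ _)) (⊙-upTo-chain-reversed gb n)

  plus-vanishingˡ : ∀ {a b} → VanishesFrom 0 a → IsGoodChain b → plusSeq a b ≗ b
  plus-vanishingˡ {b = b} va gb = ≗-trans (plus-congˡ b (vanishes-from-0 va)) (plus-identityˡ gb)

  plus-unfold : ∀ {a b} → IsGoodChain a → IsGoodChain b → plusSeq a b ≗ a 0 ⊕ₛ plusSeq (minusOneSeq a) b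
  plus-unfold {a} {b} ga gb zero = begin
    a 0 ⊕ b 0                 ≡⟨ cong (_⊕ b 0) (proj₁ (ga 0)) ⟨
    (a 0 ⊕ a 1) ⊕ b 0         ≡⟨ ⊕-assoc _ _ _ ⟩
    a 0 ⊕ (a 1 ⊕ b 0)         ≡⟨ ⊙-identityʳ _ ⟨
    (a 0 ⊕ (a 1 ⊕ b 0)) ⊙ 𝟙   ∎
    where open ≡-Reasoning
  plus-unfold {a} {b} ga gb (suc m) =
    trans (⊙-upTo-unconsˡ _ m) (cong (_⊙ Q m) (sym (≤-antisym a₀⊕Q≤a₀⊕b (⊕-monoʳ-≤ (a 0) b≤Q))))
    where
    Q : Seq
    Q = plusSeq (minusOneSeq a) b
    b≤Q : b (suc m) ≤ Q (suc m)
    b≤Q = subst (_≤ Q (suc m)) (⊙-upTo-chain-reversed gb (suc m)) (⊙-upTo-mono-≤ (suc m) (λ i _ → y≤x⊕y _ _))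
    Q≤a₁⊕b : Q (suc m) ≤ a 1 ⊕ b (suc m)
    Q≤a₁⊕b = subst (_≤ a 1 ⊕ b (suc m)) (sym (⊙-upTo-unconsˡ _ m)) (x⊙y≤x _ _)
    a₀⊕Q≤a₀⊕b : a 0 ⊕ Q (suc m) ≤ a 0 ⊕ b (suc m)
    a₀⊕Q≤a₀⊕b = subst (a 0 ⊕ Q (suc m) ≤_) (trans (sym (⊕-assoc _ _ _)) (cong (_⊕ b (suc m)) (proj₁ (ga 0))))
      (⊕-monoʳ-≤ (a 0) Q≤a₁⊕b)

  plus-chain : ∀ N {a b} → VanishesFrom N a → IsGoodChain a → IsGoodChain b → IsGoodChain (plusSeq a b)
  plus-chain zero va ga gb = chain-resp-≗ (≗-sym (plus-vanishingˡ va gb)) gb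
  plus-chain (suc N) {a} va ga gb = chain-resp-≗ (≗-sym (plus-unfold ga gb))
    (⊕ₛ-chain (plus-chain N (minusOne-vanishes va) (minusOne-chain ga) gb) (a 0))

  plus-vanishes : ∀ N {M a b} → VanishesFrom N a → IsGoodChain a → VanishesFrom M b → IsGoodChain b →
                  VanishesFrom (N + M) (plusSeq a b)
  plus-vanishes zero va ga vb gb = vanishes-resp-≗ (≗-sym (plus-vanishingˡ va gb)) vb
  plus-vanishes (suc N) {a = a} va ga vb gb = vanishes-resp-≗ (≗-sym (plus-unfold ga gb))
    (⊕ₛ-vanishes (plus-vanishes N (minusOne-vanishes va) (minusOne-chain ga) vb gb) (a 0))

  minusOne-⊕ₛ : ∀ {a} → IsGoodChain a → ∀ x → minusOneSeq (x ⊕ₛ a) ≗ (x ⊙ a 0) ⊕ₛ minusOneSeq a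
  minusOne-⊕ₛ {a} ga x zero = trans (good-interchange (ga 0) x) (sym (⊙-identityʳ _))
  minusOne-⊕ₛ {a} ga x (suc m) = begin
    (x ⊕ a (2+ m)) ⊙ a (suc m)                 ≡⟨ good-interchange (ga (suc m)) x ⟩
    (x ⊙ a (suc m)) ⊕ a (2+ m)                 ≡⟨ cong (λ w → (x ⊙ w) ⊕ a (2+ m)) a₀⊙a≡a ⟨
    (x ⊙ (a 0 ⊙ a (suc m))) ⊕ a (2+ m)         ≡⟨ cong (_⊕ a (2+ m)) (⊙-assoc _ _ _) ⟨
    ((x ⊙ a 0) ⊙ a (suc m)) ⊕ a (2+ m)         ≡⟨ good-interchange (ga (suc m)) _ ⟨
    ((x ⊙ a 0) ⊕ a (2+ m)) ⊙ a (suc m)         ∎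
    where
    open ≡-Reasoning
    a₀⊙a≡a : a 0 ⊙ a (suc m) ≡ a (suc m)
    a₀⊙a≡a = proj₂ (good-raiseˡ (ga m) (chain-≤-head ga m))

  ⊕ₛ-⊕ₛ : ∀ {a} → IsGoodChain a → ∀ x y → (x ⊕ y) ⊕ₛ ((x ⊙ y) ⊕ₛ a) ≗ x ⊕ₛ (y ⊕ₛ a)
  ⊕ₛ-⊕ₛ {a} ga x y zero = begin
    ((x ⊕ y) ⊕ (((x ⊙ y) ⊕ a 0) ⊙ 𝟙)) ⊙ 𝟙               ≡⟨ cong (((x ⊕ y) ⊕ (((x ⊙ y) ⊕ a 0) ⊙ 𝟙)) ⊙_) (⊕-zeroʳ (x ⊙ y)) ⟨
    ((x ⊕ y) ⊕ (((x ⊙ y) ⊕ a 0) ⊙ 𝟙)) ⊙ ((x ⊙ y) ⊕ 𝟙)  ≡⟨ ⊕⊙-nested (𝟙∷ₛ-chain ga 0) x y ⟩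
    (x ⊕ ((y ⊕ a 0) ⊙ 𝟙)) ⊙ (y ⊕ 𝟙)                     ≡⟨ cong ((x ⊕ ((y ⊕ a 0) ⊙ 𝟙)) ⊙_) (⊕-zeroʳ y) ⟩
    (x ⊕ ((y ⊕ a 0) ⊙ 𝟙)) ⊙ 𝟙                           ∎
    where open ≡-Reasoning
  ⊕ₛ-⊕ₛ {a} ga x y (suc m) = begin
    ((x ⊕ y) ⊕ (((x ⊙ y) ⊕ a (suc m)) ⊙ a m)) ⊙ (((x ⊙ y) ⊕ a m) ⊙ c)   ≡⟨ ⊙-assoc _ _ _ ⟨
    (((x ⊕ y) ⊕ (((x ⊙ y) ⊕ a (suc m)) ⊙ a m)) ⊙ ((x ⊙ y) ⊕ a m)) ⊙ c   ≡⟨ cong (_⊙ c) (⊕⊙-nested (ga m) x y) ⟩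
    ((x ⊕ ((y ⊕ a (suc m)) ⊙ a m)) ⊙ (y ⊕ a m)) ⊙ c                     ≡⟨ ⊙-assoc _ _ _ ⟩
    (x ⊕ ((y ⊕ a (suc m)) ⊙ a m)) ⊙ ((y ⊕ a m) ⊙ c)                     ∎
    where
    open ≡-Reasoning
    c : Carrier
    c = (𝟙 ∷ₛ a) m

  ⊕ₛ-vanishing : ∀ {a} → a ≗ zeroSeq → ∀ x → x ⊕ₛ a ≗ x ∷ₛ zeroSeq
  ⊕ₛ-vanishing a≗0 x zero = trans (⊙-identityʳ _) (trans (cong (x ⊕_) (a≗0 0)) (⊕-identityʳ x))
  ⊕ₛ-vanishing {a} a≗0 x (suc n) = trans (cong ((x ⊕ a (suc n)) ⊙_) (a≗0 n)) (⊙-zeroʳ _)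

  plus-singletonˡ : ∀ x {c} → IsGoodChain c → plusSeq (x ∷ₛ zeroSeq) c ≗ x ⊕ₛ c
  plus-singletonˡ x gc = ≗-trans (plus-unfold (∷ₛ𝟘-chain x) gc) (⊕ₛ-congʳ x (plus-identityˡ gc))

  plus-⊕ₛˡ : ∀ N {a c} → VanishesFrom N a → IsGoodChain a → IsGoodChain c →
             ∀ x → plusSeq (x ⊕ₛ a) c ≗ x ⊕ₛ plusSeq a c
  plus-⊕ₛˡ zero {a} {c} va ga gc x = begin
    plusSeq (x ⊕ₛ a) c           ≈⟨ plus-congˡ c (⊕ₛ-vanishing (vanishes-from-0 va) x) ⟩
    plusSeq (x ∷ₛ zeroSeq) c     ≈⟨ plus-singletonˡ x gc ⟩
    x ⊕ₛ c                       ≈⟨ ⊕ₛ-congʳ x (plus-vanishingˡ va gc) ⟨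
    x ⊕ₛ plusSeq a c             ∎
    where open ≗-Reasoning
  plus-⊕ₛˡ (suc N) {a} {c} va ga gc x = begin
    plusSeq (x ⊕ₛ a) c                                    ≈⟨ plus-unfold (⊕ₛ-chain ga x) gc ⟩
    ((x ⊕ a 0) ⊙ 𝟙) ⊕ₛ plusSeq (minusOneSeq (x ⊕ₛ a)) c   ≈⟨ ⊕ₛ-cong (⊙-identityʳ _) (plus-congˡ c (minusOne-⊕ₛ ga x)) ⟩
    (x ⊕ a 0) ⊕ₛ plusSeq ((x ⊙ a 0) ⊕ₛ a′) c              ≈⟨ ⊕ₛ-congʳ _ (plus-⊕ₛˡ N va′ ga′ gc _) ⟩
    (x ⊕ a 0) ⊕ₛ ((x ⊙ a 0) ⊕ₛ plusSeq a′ c)              ≈⟨ ⊕ₛ-⊕ₛ (plus-chain N va′ ga′ gc) x (a 0) ⟩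
    x ⊕ₛ (a 0 ⊕ₛ plusSeq a′ c)                            ≈⟨ ⊕ₛ-congʳ x (plus-unfold ga gc) ⟨
    x ⊕ₛ plusSeq a c                                      ∎
    where
    open ≗-Reasoning
    a′ : Seq
    a′ = minusOneSeq a
    va′ : VanishesFrom N a′
    va′ = minusOne-vanishes va
    ga′ : IsGoodChain a′
    ga′ = minusOne-chain ga

  plus-assoc : ∀ N {M a b c} → VanishesFrom N a → IsGoodChain a → VanishesFrom M b → IsGoodChain b → IsGoodChain c →
               plusSeq (plusSeq a b) c ≗ plusSeq a (plusSeq b c)
  plus-assoc zero {M} {a} {b} {c} va ga vb gb gc = begin
    plusSeq (plusSeq a b) c      ≈⟨ plus-congˡ c (plus-vanishingˡ va gb) ⟩
    plusSeq b c                  ≈⟨ plus-vanishingˡ va (plus-chain M vb gb gc) ⟨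
    plusSeq a (plusSeq b c)      ∎
    where open ≗-Reasoning
  plus-assoc (suc N) {M} {a} {b} {c} va ga vb gb gc = begin
    plusSeq (plusSeq a b) c                  ≈⟨ plus-congˡ c (plus-unfold ga gb) ⟩
    plusSeq (a 0 ⊕ₛ plusSeq a′ b) c          ≈⟨ plus-⊕ₛˡ (N + M) (plus-vanishes N va′ ga′ vb gb)
                                                          (plus-chain N va′ ga′ gb) gc (a 0) ⟩
    a 0 ⊕ₛ plusSeq (plusSeq a′ b) c          ≈⟨ ⊕ₛ-congʳ (a 0) (plus-assoc N va′ ga′ vb gb gc) ⟩
    a 0 ⊕ₛ plusSeq a′ (plusSeq b c)          ≈⟨ plus-unfold ga (plus-chain M vb gb gc) ⟨
    plusSeq a (plusSeq b c)                  ∎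
    where
    open ≗-Reasoning
    a′ : Seq
    a′ = minusOneSeq a
    va′ : VanishesFrom N a′
    va′ = minusOne-vanishes va
    ga′ : IsGoodChain a′
    ga′ = minusOne-chain ga

  pointwise : Op₂ Carrier → Seq → Seq → Seq
  pointwise _∘_ a b n = a n ∘ b n

  pointwise-cong : ∀ _∘_ {a a′ b b′} → a ≗ a′ → b ≗ b′ → pointwise _∘_ a b ≗ pointwise _∘_ a′ b′
  pointwise-cong _∘_ a≗a′ b≗b′ n = cong₂ _∘_ (a≗a′ n) (b≗b′ n)

  ∷ₛ-pointwise : ∀ _∘_ {x} → x ∘ x ≡ x → ∀ a b → x ∷ₛ pointwise _∘_ a b ≗ pointwise _∘_ (x ∷ₛ a) (x ∷ₛ b)
  ∷ₛ-pointwise _∘_ x∘x≡x a b zero = sym x∘x≡x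
  ∷ₛ-pointwise _∘_ x∘x≡x a b (suc n) = refl

  join-chain : ∀ {a b} → IsGoodChain a → IsGoodChain b → IsGoodChain (joinSeq a b)
  join-chain ga gb n = ∨-good (ga n) (gb n)

  meet-chain : ∀ {a b} → IsGoodChain a → IsGoodChain b → IsGoodChain (meetSeq a b)
  meet-chain ga gb n = ∧-good (ga n) (gb n)

  ⊕ₛ-distrib-∨ : ∀ {a b} → IsGoodChain a → IsGoodChain b → ∀ x → x ⊕ₛ joinSeq a b ≗ joinSeq (x ⊕ₛ a) (x ⊕ₛ b)
  ⊕ₛ-distrib-∨ {a} {b} ga gb x n =
    trans (cong ((x ⊕ (a n ∨ b n)) ⊙_) (∷ₛ-pointwise _∨_ (∨-idem 𝟙) a b n))
          (⊕⊙-distrib-∨ (𝟙∷ₛ-chain ga n) (𝟙∷ₛ-chain gb n) x)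

  ⊕ₛ-distrib-∧ : ∀ {a b} → IsGoodChain a → IsGoodChain b → ∀ x → x ⊕ₛ meetSeq a b ≗ meetSeq (x ⊕ₛ a) (x ⊕ₛ b)
  ⊕ₛ-distrib-∧ {a} {b} ga gb x n =
    trans (cong ((x ⊕ (a n ∧ b n)) ⊙_) (∷ₛ-pointwise _∧_ (∧-idem 𝟙) a b n))
          (⊕⊙-distrib-∧ (𝟙∷ₛ-chain ga n) (𝟙∷ₛ-chain gb n) x)

  module _ {_∘_ : Op₂ Carrier}
           (∘-chain : ∀ {b c} → IsGoodChain b → IsGoodChain c → IsGoodChain (pointwise _∘_ b c))
           (⊕ₛ-distrib : ∀ {b c} → IsGoodChain b → IsGoodChain c →
                         ∀ x → x ⊕ₛ pointwise _∘_ b c ≗ pointwise _∘_ (x ⊕ₛ b) (x ⊕ₛ c))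
           where

    plus-distribˡ : ∀ N {a b c} → VanishesFrom N a → IsGoodChain a → IsGoodChain b → IsGoodChain c →
                    plusSeq a (pointwise _∘_ b c) ≗ pointwise _∘_ (plusSeq a b) (plusSeq a c)
    plus-distribˡ zero va ga gb gc =
      ≗-trans (plus-vanishingˡ va (∘-chain gb gc))
              (≗-sym (pointwise-cong _∘_ (plus-vanishingˡ va gb) (plus-vanishingˡ va gc)))
    plus-distribˡ (suc N) {a} {b} {c} va ga gb gc = begin
      plusSeq a (pointwise _∘_ b c)                                   ≈⟨ plus-unfold ga (∘-chain gb gc) ⟩
      a 0 ⊕ₛ plusSeq a′ (pointwise _∘_ b c)                           ≈⟨ ⊕ₛ-congʳ (a 0) (plus-distribˡ N va′ ga′ gb gc) ⟩
      a 0 ⊕ₛ pointwise _∘_ (plusSeq a′ b) (plusSeq a′ c)              ≈⟨ ⊕ₛ-distrib (plus-chain N va′ ga′ gb)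
                                                                                      (plus-chain N va′ ga′ gc) (a 0) ⟩
      pointwise _∘_ (a 0 ⊕ₛ plusSeq a′ b) (a 0 ⊕ₛ plusSeq a′ c)      ≈⟨ pointwise-cong _∘_ (plus-unfold ga gb) (plus-unfold ga gc) ⟨
      pointwise _∘_ (plusSeq a b) (plusSeq a c)                       ∎
      where
      open ≗-Reasoning
      a′ : Seq
      a′ = minusOneSeq a
      va′ : VanishesFrom N a′
      va′ = minusOne-vanishes va
      ga′ : IsGoodChain a′
      ga′ = minusOne-chain ga

  plus-distribˡ-∨ : ∀ N {a b c} → VanishesFrom N a → IsGoodChain a → IsGoodChain b → IsGoodChain c →
                    plusSeq a (joinSeq b c) ≗ joinSeq (plusSeq a b) (plusSeq a c)
  plus-distribˡ-∨ = plus-distribˡ {_∨_} join-chain ⊕ₛ-distrib-∨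

  plus-distribˡ-∧ : ∀ N {a b c} → VanishesFrom N a → IsGoodChain a → IsGoodChain b → IsGoodChain c →
                    plusSeq a (meetSeq b c) ≗ meetSeq (plusSeq a b) (plusSeq a c)
  plus-distribˡ-∧ = plus-distribˡ {_∧_} meet-chain ⊕ₛ-distrib-∧

  pointwise-vanishes : ∀ _∘_ {N M a b} → 𝟘 ∘ 𝟘 ≡ 𝟘 → VanishesFrom N a → VanishesFrom M b →
                       VanishesFrom (N + M) (pointwise _∘_ a b)
  pointwise-vanishes _∘_ {N} 𝟘∘𝟘≡𝟘 va vb n N+M≤n =
    trans (cong₂ _∘_ (va n (ℕ.m+n≤o⇒m≤o N N+M≤n)) (vb n (ℕ.m+n≤o⇒n≤o N N+M≤n))) 𝟘∘𝟘≡𝟘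

  oneSeq-singleton : oneSeq ≗ 𝟙 ∷ₛ zeroSeq
  oneSeq-singleton zero = refl
  oneSeq-singleton (suc n) = refl

  plus-oneˡ : ∀ {a} → IsGoodChain a → plusSeq oneSeq a ≗ 𝟙 ∷ₛ a
  plus-oneˡ {a} ga = begin
    plusSeq oneSeq a               ≈⟨ plus-congˡ a oneSeq-singleton ⟩
    plusSeq (𝟙 ∷ₛ zeroSeq) a       ≈⟨ plus-singletonˡ 𝟙 ga ⟩
    𝟙 ⊕ₛ a                         ≈⟨ 𝟙⊕ₛ a ⟩
    𝟙 ∷ₛ a                         ∎
    where open ≗-Reasoning

  𝟙∷ₛ-minusOne : ∀ a → 𝟙 ∷ₛ minusOneSeq a ≗ joinSeq a oneSeq
  𝟙∷ₛ-minusOne a zero = sym (∨-zeroʳ (a 0))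
  𝟙∷ₛ-minusOne a (suc n) = sym (∨-identityʳ (a (suc n)))

  closure : Closure
  closure = record
    { zero-good = (0 , λ _ _ → refl) , (λ _ → ⊕-identityʳ 𝟘 , ⊙-zeroʳ 𝟘)
    ; one-good = (1 , λ { (suc n) _ → refl }) , chain-resp-≗ (≗-sym oneSeq-singleton) (∷ₛ𝟘-chain 𝟙)
    ; plus-good = λ { ((N , va) , ga) ((M , vb) , gb) → (N + M , plus-vanishes N va ga vb gb) , plus-chain N va ga gb }
    ; join-good = λ { ((N , va) , ga) ((M , vb) , gb) →
        (N + M , pointwise-vanishes _∨_ (∨-idem 𝟘) va vb) , join-chain ga gb }
    ; meet-good = λ { ((N , va) , ga) ((M , vb) , gb) →
        (N + M , pointwise-vanishes _∧_ (∧-idem 𝟘) va vb) , meet-chain ga gb }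
    ; minusOne-good = λ { ((N , va) , ga) → (N , λ n N≤n → va (suc n) (ℕ.m≤n⇒m≤1+n N≤n)) , minusOne-chain ga }
    }

module GoodSequenceMonoid (A : MVMonoidal) where
  open MVMonoidal A
  open MVMonoidalProperties A
  open GoodSequences A
  open GoodSequenceProperties A
  open Ops closure

  GS-setoid : Setoid 0ℓ 0ℓ
  GS-setoid = record
    { Carrier = GS
    ; _≈_ = _≈GS_
    ; isEquivalence = On.isEquivalence (proj₁ {B = IsGoodSeq}) (Setoid.isEquivalence (ℕ →-setoid Carrier))
    }

  open AlgebraConsequences GS-setoid using (comm∧distrˡ⇒distr; comm∧idˡ⇒id)

  isDistributiveLattice-GS : IsDistributiveLattice _≈GS_ _∨GS_ _∧GS_
  isDistributiveLattice-GS = record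
    { isLattice = record
      { isEquivalence = Setoid.isEquivalence GS-setoid
      ; ∨-comm = λ x y n → ∨-comm (proj₁ x n) (proj₁ y n)
      ; ∨-assoc = λ x y z n → ∨-assoc (proj₁ x n) (proj₁ y n) (proj₁ z n)
      ; ∨-cong = pointwise-cong _∨_
      ; ∧-comm = λ x y n → ∧-comm (proj₁ x n) (proj₁ y n)
      ; ∧-assoc = λ x y z n → ∧-assoc (proj₁ x n) (proj₁ y n) (proj₁ z n)
      ; ∧-cong = pointwise-cong _∧_
      ; absorptive = (λ x y n → ∨-absorbs-∧ (proj₁ x n) (proj₁ y n))
                   , (λ x y n → ∧-absorbs-∨ (proj₁ x n) (proj₁ y n))
      }
    ; ∨-distrib-∧ = (λ x y z n → proj₁ ∨-distrib-∧ (proj₁ x n) (proj₁ y n) (proj₁ z n))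
                  , (λ x y z n → proj₂ ∨-distrib-∧ (proj₁ x n) (proj₁ y n) (proj₁ z n))
    ; ∧-distrib-∨ = (λ x y z n → proj₁ ∧-distrib-∨ (proj₁ x n) (proj₁ y n) (proj₁ z n))
                  , (λ x y z n → proj₂ ∧-distrib-∨ (proj₁ x n) (proj₁ y n) (proj₁ z n))
    }

  +GS-comm : ∀ (x y : GS) → (x +GS y) ≈GS (y +GS x)
  +GS-comm (a , _) (b , _) = plus-comm a b

  +GS-identityˡ : ∀ (x : GS) → (𝟎 +GS x) ≈GS x
  +GS-identityˡ (a , _ , ga) = plus-identityˡ ga

  +GS-assoc : ∀ (x y z : GS) → ((x +GS y) +GS z) ≈GS (x +GS (y +GS z))
  +GS-assoc (a , (N , va) , ga) (b , (M , vb) , gb) (c , _ , gc) = plus-assoc N va ga vb gb gc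

  +GS-distribˡ-∨ : ∀ (x y z : GS) → (x +GS (y ∨GS z)) ≈GS ((x +GS y) ∨GS (x +GS z))
  +GS-distribˡ-∨ (a , (N , va) , ga) (b , _ , gb) (c , _ , gc) = plus-distribˡ-∨ N va ga gb gc

  +GS-distribˡ-∧ : ∀ (x y z : GS) → (x +GS (y ∧GS z)) ≈GS ((x +GS y) ∧GS (x +GS z))
  +GS-distribˡ-∧ (a , (N , va) , ga) (b , _ , gb) (c , _ , gc) = plus-distribˡ-∧ N va ga gb gc

  +GS-isCommutativeMonoid : IsCommutativeMonoid _≈GS_ _+GS_ 𝟎
  +GS-isCommutativeMonoid = record
    { isMonoid = record
      { isSemigroup = record
        { isMagma = record { isEquivalence = Setoid.isEquivalence GS-setoid ; ∙-cong = plus-cong }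
        ; assoc = +GS-assoc
        }
      ; identity = comm∧idˡ⇒id {_+GS_} +GS-comm {𝟎} +GS-identityˡ
      }
    ; comm = +GS-comm
    }

  times1-GS : ℕ → GS
  times1-GS = times1 _≈GS_ _+GS_ 𝟎 𝟏

  times1-below : ∀ k n → n <ℕ k → proj₁ (times1-GS k) n ≡ 𝟙
  times1-below (suc k) zero _ = plus-oneˡ (proj₂ (proj₂ (times1-GS k))) zero
  times1-below (suc k) (suc n) (s≤s n<k) =
    trans (plus-oneˡ (proj₂ (proj₂ (times1-GS k))) (suc n)) (times1-below k n n<k)

  ≤-times1 : ∀ (x : GS) → ∃ λ k → ∀ n → proj₁ x n ≤ proj₁ (times1-GS k) n
  ≤-times1 (a , (N , va) , ga) = N , entry≤
    where
    entry≤ : ∀ n → a n ≤ proj₁ (times1-GS N) n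
    entry≤ n with n ℕ.<? N
    ... | yes n<N = subst (a n ≤_) (sym (times1-below N n n<N)) (𝟙-maximum (a n))
    ... | no n≮N = subst (_≤ _) (sym (va n (ℕ.≮⇒≥ n≮N))) (𝟘-minimum _)

  isPUCLMonoid : IsPUCLMonoid _≈GS_ _+GS_ _∨GS_ _∧GS_ 𝟎 𝟏 _⊖1GS
  isPUCLMonoid = record
    { isDistributiveLattice = isDistributiveLattice-GS
    ; +-isCommutativeMonoid = +GS-isCommutativeMonoid
    ; +-distrib-∨ = comm∧distrˡ⇒distr {_+GS_} {_∨GS_} (pointwise-cong _∨_) +GS-comm +GS-distribˡ-∨
    ; +-distrib-∧ = comm∧distrˡ⇒distr {_+GS_} {_∧GS_} (pointwise-cong _∧_) +GS-comm +GS-distribˡ-∧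
    ; ⊖1-cong = λ x≈y n → x≈y (suc n)
    ; positive = λ x n → sym (𝟘-minimum (proj₁ x n))
    ; +1⊖1 = λ { (a , _ , ga) n → trans (plus-comm a oneSeq (suc n)) (plus-oneˡ ga (suc n)) }
    ; ⊖1+1 = λ { (a , _ , ga) n → trans (plus-comm (minusOneSeq a) oneSeq n)
                                    (trans (plus-oneˡ (minusOne-chain ga) n) (𝟙∷ₛ-minusOne a n)) }
    ; unital = λ x → let k , x≤k = ≤-times1 x in k , λ n → sym (x≤k n)
    }

proposition7p24 : (A : MVMonoidal) → let open GoodSequences A in
    Σ Closure (λ cl → let open Ops cl in
      IsPUCLMonoid _≈GS_ _+GS_ _∨GS_ _∧GS_ 𝟎 𝟏 _⊖1GS)
proposition7p24 A = GoodSequenceProperties.closure A , GoodSequenceMonoid.isPUCLMonoid A
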